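{- Let $(G,+)$ be a divisible torsion-free abelian group and let $0\to\mathbb{Z}\xrightarrow{\iota}G\xrightarrow{\pi}\mathbb{R}/\mathbb{Z}\to 0$ be an exact sequence of groups. Let $\hat\pi:G\to\widehat{\mathbb{R}/\mathbb{Z}}$ be the map $g\mapsto(\pi(g/n))_{n\in\mathbb{N}^*}$. Then $\hat\pi$ has dense image in $\widehat{\mathbb{R}/\mathbb{Z}}$.
   Context: Since $G$ is divisible and torsion-free, $g/n$ denotes the unique $y\in G$ with $ny=g$. $\widehat{\mathbb{R}/\mathbb{Z}}$ is the inverse limit of the finite covers $\mathbb{R}/\mathbb{Z}\xrightarrow{k}\mathbb{R}/\mathbb{Z}$, i.e. the group of sequences $(h_i)_{i\in\mathbb{N}^*}$ in $\mathbb{R}/\mathbb{Z}$ with $kh_{ik}=h_i$ for all positive integers $i,k$. A subset $S\subseteq\widehat{\mathbb{R}/\mathbb{Z}}$ is dense if for every $x\in\widehat{\mathbb{R}/\mathbb{Z}}$ and every finite $F\subseteq\mathbb{N}^*$ there is $y\in S$ with $y_i=x_i$ for all $i\in F$. -}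

module Defs where

open import Level using (Level; _⊔_)
open import Data.Nat as ℕ using (ℕ; _≤_; _<_)
open import Data.Integer as ℤ using (ℤ)
open import Data.Rational as ℚ using (ℚ; 0ℚ; ∣_∣)
open import Data.Product using (Σ; ∃; _×_; proj₁)
open import Data.List using (List)
open import Data.List.Membership.Propositional using (_∈_)
open import Relation.Binary.PropositionalEquality using (_≡_)
open import Algebra.Bundles using (AbelianGroup)
import Algebra.Definitions.RawMonoid as RM

-- Real numbers, as (raw) Cauchy sequences of rationals.

IsCauchy : (ℕ → ℚ) → Set
IsCauchy x = ∀ (ε : ℚ) → 0ℚ ℚ.< ε →
  ∃ λ (N : ℕ) → ∀ m n → N ≤ m → N ≤ n → ∣ x m ℚ.- x n ∣ ℚ.≤ ε

ℝ : Set
ℝ = Σ (ℕ → ℚ) IsCauchy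

ConvergesToDiff : (ℕ → ℚ) → (ℕ → ℚ) → ℤ → Set
ConvergesToDiff x y k = ∀ (ε : ℚ) → 0ℚ ℚ.< ε →
  ∃ λ (N : ℕ) → ∀ n → N ≤ n → ∣ (x n ℚ.- y n) ℚ.- (k ℚ./ 1) ∣ ℚ.≤ ε

-- ℝ/ℤ : carrier ℝ, with equality "difference is an integer".
-- Group operations are computed on representatives (pointwise on
-- Cauchy sequences), so they are stated on the underlying sequences.

_≈ᵀ_ : ℝ → ℝ → Set
x ≈ᵀ y = ∃ λ (k : ℤ) → ConvergesToDiff (proj₁ x) (proj₁ y) k

IsSumᵀ : ℝ → ℝ → ℝ → Set
IsSumᵀ z x y = ∃ λ (k : ℤ) →
  ConvergesToDiff (proj₁ z) (λ n → proj₁ x n ℚ.+ proj₁ y n) k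

IsMultipleᵀ : ℝ → ℕ → ℝ → Set
IsMultipleᵀ z k x = ∃ λ (j : ℤ) →
  ConvergesToDiff (proj₁ z) (λ n → (ℤ.+ k ℚ./ 1) ℚ.* proj₁ x n) j

IsZeroᵀ : ℝ → Set
IsZeroᵀ z = ∃ λ (k : ℤ) → ConvergesToDiff (proj₁ z) (λ _ → 0ℚ) k

-- The profinite completion \widehat{ℝ/ℤ}: families (h_i)_{i ≥ 1}
-- with k · h_{ik} = h_i for all positive i, k.  (Index 0 is unused.)

IsCompatible : (ℕ → ℝ) → Set
IsCompatible h = ∀ i k → 0 < i → 0 < k → IsMultipleᵀ (h i) k (h (i ℕ.* k))

module _ {c ℓ : Level} (G : AbelianGroup c ℓ) where
  open AbelianGroup G renaming (Carrier to |G|)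
  open RM rawMonoid using () renaming (_×_ to _·_)

  IsDivisible : Set (c ⊔ ℓ)
  IsDivisible = ∀ (n : ℕ) → 0 < n → ∀ (g : |G|) → ∃ λ (y : |G|) → (n · y) ≈ g

  IsTorsionFree : Set (c ⊔ ℓ)
  IsTorsionFree = ∀ (n : ℕ) → 0 < n → ∀ (y : |G|) → (n · y) ≈ ε → y ≈ ε

  record IsShortExact (ι : ℤ → |G|) (π : |G| → ℝ) : Set (c ⊔ ℓ) where
    field
      ι-hom       : ∀ a b → ι (a ℤ.+ b) ≈ (ι a ∙ ι b)
      ι-injective : ∀ a b → ι a ≈ ι b → a ≡ b
      π-cong      : ∀ g h → g ≈ h → π g ≈ᵀ π h
      π-hom       : ∀ g h → IsSumᵀ (π (g ∙ h)) (π g) (π h)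
      π-surjective : ∀ (r : ℝ) → ∃ λ (g : |G|) → π g ≈ᵀ r
      ker⊆im      : ∀ g → IsZeroᵀ (π g) → ∃ λ (k : ℤ) → ι k ≈ g
      im⊆ker      : ∀ k → IsZeroᵀ (π (ι k))

  -- \hat π g has i-th component π(g/i), where g/i is the unique y with
  -- i·y = g.  Density of the image of \hat π:
  HatπDense : (π : |G| → ℝ) → Set (c ⊔ ℓ)
  HatπDense π = ∀ (x : ℕ → ℝ) → IsCompatible x → ∀ (F : List ℕ) →
    ∃ λ (g : |G|) → ∀ i → i ∈ F → 0 < i →
      ∀ (y : |G|) → (i · y) ≈ g → π y ≈ᵀ x i

module Submission where

-- Let N be the product of the positive indices in F and pick h with π h = x_N.
-- For i ∈ F with N = i m, every y with i y = N h equals m h since G is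
-- torsion-free, hence π y = m x_N = m x_{i m} = x_i by compatibility of x.

open import Defs
open import Level using (Level; 0ℓ)
open import Data.Nat as ℕ using (ℕ; zero; suc; >-nonZero; >-nonZero⁻¹)
import Data.Nat.Properties as ℕP
open import Data.Nat.Divisibility using (quotient; quotient≢0; m∣n⇒n≡m*quotient)
open import Data.Nat.ListAction using (product)
open import Data.Nat.ListAction.Properties using (∈⇒∣product; product≢0)
open import Data.Integer as ℤ using (ℤ)
import Data.Integer.Properties as ℤP
open import Data.Rational as ℚ using (ℚ; 0ℚ; 1ℚ; ½; ∣_∣; _/_; toℚᵘ)
import Data.Rational.Properties as ℚP
import Data.Rational.Unnormalised as ℚᵘ
import Data.Rational.Unnormalised.Properties as ℚᵘP
open import Data.Rational.Solver using (module +-*-Solver)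
open +-*-Solver
open import Data.Product using (∃; _×_; _,_; proj₁; proj₂)
open import Data.List using (List; filter)
open import Data.List.Membership.Propositional using (_∈_)
open import Data.List.Membership.Propositional.Properties using (∈-filter⁺)
import Data.List.Relation.Unary.All as All
open import Data.List.Relation.Unary.All.Properties using (all-filter)
open import Relation.Binary.Bundles using (Setoid)
open import Relation.Binary.PropositionalEquality as ≡ using (_≡_)
import Relation.Binary.Reasoning.Setoid as SetoidReasoning
open import Algebra.Bundles using (AbelianGroup)
import Algebra.Definitions.RawMonoid as RawMonoidDefinitions
import Algebra.Properties.Monoid.Mult as MonoidMult
import Algebra.Properties.CommutativeMonoid.Mult as CommutativeMonoidMult
import Algebra.Properties.Group as GroupProperties

Seq : Set
Seq = ℕ → ℚ

_+ₛ_ : Seq → Seq → Seq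
(s +ₛ t) n = s n ℚ.+ t n

_·ₛ_ : ℕ → Seq → Seq
(m ·ₛ s) n = (ℤ.+ m / 1) ℚ.* s n

ConvergesTo : Seq → ℚ → Set
ConvergesTo s q = ∀ ε → 0ℚ ℚ.< ε → ∃ λ N → ∀ n → N ℕ.≤ n → ∣ s n ℚ.- q ∣ ℚ.≤ ε

ConvergesTo-const : ∀ q → ConvergesTo (λ _ → q) q
ConvergesTo-const q ε 0<ε =
  0 , λ _ _ → ℚP.≤-trans (ℚP.≤-reflexive (≡.cong ∣_∣ (ℚP.+-inverseʳ q))) (ℚP.<⇒≤ 0<ε)

ConvergesTo-cong : ∀ {s t q} → (∀ n → s n ≡ t n) → ConvergesTo s q → ConvergesTo t q
ConvergesTo-cong {q = q} s≡t s→q ε 0<ε with s→q ε 0<ε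
... | N , close = N , λ n N≤n → ≡.subst (λ r → ∣ r ℚ.- q ∣ ℚ.≤ ε) (s≡t n) (close n N≤n)

ConvergesTo-neg : ∀ {s q} → ConvergesTo s q → ConvergesTo (λ n → ℚ.- s n) (ℚ.- q)
ConvergesTo-neg {s} {q} s→q ε 0<ε with s→q ε 0<ε
... | N , close = N , λ n N≤n → ℚP.≤-trans (ℚP.≤-reflexive (distance-neg (s n))) (close n N≤n)
  where
  distance-neg : ∀ a → ∣ ℚ.- a ℚ.- ℚ.- q ∣ ≡ ∣ a ℚ.- q ∣
  distance-neg a = ≡.trans
    (≡.cong ∣_∣ (solve 2 (λ a q → (:- a) :- (:- q) := :- (a :- q)) ≡.refl a q))
    (ℚP.∣-p∣≡∣p∣ (a ℚ.- q))

½*-pos : ∀ {ε} → 0ℚ ℚ.< ε → 0ℚ ℚ.< ½ ℚ.* ε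
½*-pos 0<ε = ℚP.<-respˡ-≡ (ℚP.*-zeroʳ ½) (ℚP.*-monoʳ-<-pos ½ 0<ε)

ConvergesTo-+ : ∀ {s t p q} → ConvergesTo s p → ConvergesTo t q → ConvergesTo (s +ₛ t) (p ℚ.+ q)
ConvergesTo-+ {s} {t} {p} {q} s→p t→q ε 0<ε
  with s→p (½ ℚ.* ε) (½*-pos 0<ε) | t→q (½ ℚ.* ε) (½*-pos 0<ε)
... | N₁ , close₁ | N₂ , close₂ = N₁ ℕ.⊔ N₂ , λ n N≤n → begin
  ∣ (s n ℚ.+ t n) ℚ.- (p ℚ.+ q) ∣   ≡⟨ ≡.cong ∣_∣ (regroup (s n) (t n)) ⟩
  ∣ (s n ℚ.- p) ℚ.+ (t n ℚ.- q) ∣   ≤⟨ ℚP.∣p+q∣≤∣p∣+∣q∣ (s n ℚ.- p) (t n ℚ.- q) ⟩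
  ∣ s n ℚ.- p ∣ ℚ.+ ∣ t n ℚ.- q ∣   ≤⟨ ℚP.+-mono-≤ (close₁ n (ℕP.m⊔n≤o⇒m≤o N₁ N₂ N≤n))
                                                      (close₂ n (ℕP.m⊔n≤o⇒n≤o N₁ N₂ N≤n)) ⟩
  ½ ℚ.* ε ℚ.+ ½ ℚ.* ε               ≡⟨ ≡.trans (≡.sym (ℚP.*-distribʳ-+ ε ½ ½)) (ℚP.*-identityˡ ε) ⟩
  ε                                 ∎
  where
  open ℚP.≤-Reasoning
  regroup : ∀ a b → (a ℚ.+ b) ℚ.- (p ℚ.+ q) ≡ (a ℚ.- p) ℚ.+ (b ℚ.- q)
  regroup a b = solve 4 (λ a b p q → (a :+ b) :- (p :+ q) := (a :- p) :+ (b :- q)) ≡.refl a b p q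

-- toℚᵘ (k / 1) ≃ mkℚᵘ k 0, on which the unnormalised operations compute.
/1-homo-+ : ∀ k l → k / 1 ℚ.+ l / 1 ≡ (k ℤ.+ l) / 1
/1-homo-+ k l = ℚP.toℚᵘ-injective (begin
  toℚᵘ (k / 1 ℚ.+ l / 1)          ≈⟨ ℚP.toℚᵘ-homo-+ (k / 1) (l / 1) ⟩
  toℚᵘ (k / 1) ℚᵘ.+ toℚᵘ (l / 1)  ≈⟨ ℚᵘP.+-cong (ℚP.toℚᵘ-fromℚᵘ (ℚᵘ.mkℚᵘ k 0)) (ℚP.toℚᵘ-fromℚᵘ (ℚᵘ.mkℚᵘ l 0)) ⟩
  ℚᵘ.mkℚᵘ k 0 ℚᵘ.+ ℚᵘ.mkℚᵘ l 0    ≈⟨ ℚᵘP.≃-reflexive (≡.cong₂ (λ a b → ℚᵘ.mkℚᵘ (a ℤ.+ b) 0) (ℤP.*-identityʳ k) (ℤP.*-identityʳ l)) ⟩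
  ℚᵘ.mkℚᵘ (k ℤ.+ l) 0             ≈⟨ ℚP.toℚᵘ-fromℚᵘ (ℚᵘ.mkℚᵘ (k ℤ.+ l) 0) ⟨
  toℚᵘ ((k ℤ.+ l) / 1)            ∎)
  where open ℚᵘP.≃-Reasoning

/1-homo-neg : ∀ k → ℚ.- (k / 1) ≡ (ℤ.- k) / 1
/1-homo-neg k = ℚP.toℚᵘ-injective (begin
  toℚᵘ (ℚ.- (k / 1))     ≈⟨ ℚP.toℚᵘ-homo‿- (k / 1) ⟩
  ℚᵘ.- toℚᵘ (k / 1)      ≈⟨ ℚᵘP.-‿cong (ℚP.toℚᵘ-fromℚᵘ (ℚᵘ.mkℚᵘ k 0)) ⟩
  ℚᵘ.mkℚᵘ (ℤ.- k) 0      ≈⟨ ℚP.toℚᵘ-fromℚᵘ (ℚᵘ.mkℚᵘ (ℤ.- k) 0) ⟨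
  toℚᵘ ((ℤ.- k) / 1)     ∎)
  where open ℚᵘP.≃-Reasoning

ConvergesToℤ : Seq → Set
ConvergesToℤ s = ∃ λ k → ConvergesTo s (k / 1)

ConvergesToℤ-0 : ConvergesToℤ (λ _ → 0ℚ)
ConvergesToℤ-0 = ℤ.+ 0 , ConvergesTo-const 0ℚ

ConvergesToℤ-cong : ∀ {s t} → (∀ n → s n ≡ t n) → ConvergesToℤ s → ConvergesToℤ t
ConvergesToℤ-cong s≡t (k , s→k) = k , ConvergesTo-cong s≡t s→k

ConvergesToℤ-neg : ∀ {s} → ConvergesToℤ s → ConvergesToℤ (λ n → ℚ.- s n)
ConvergesToℤ-neg {s} (k , s→k) = ℤ.- k , ≡.subst (ConvergesTo (λ n → ℚ.- s n)) (/1-homo-neg k) (ConvergesTo-neg {s} s→k)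

ConvergesToℤ-+ : ∀ {s t} → ConvergesToℤ s → ConvergesToℤ t → ConvergesToℤ (s +ₛ t)
ConvergesToℤ-+ {s} {t} (k , s→k) (l , t→l) =
  k ℤ.+ l , ≡.subst (ConvergesTo (s +ₛ t)) (/1-homo-+ k l) (ConvergesTo-+ {s} {t} s→k t→l)

-- Congruence modulo sequences tending to an integer: the relations _≈ᵀ_, IsSumᵀ,
-- IsMultipleᵀ and IsZeroᵀ of Defs all unfold to instances of _≋_.
infix 4 _≋_
_≋_ : Seq → Seq → Set
s ≋ t = ConvergesToℤ (λ n → s n ℚ.- t n)

≡⇒≋ : ∀ {s t} → (∀ n → s n ≡ t n) → s ≋ t
≡⇒≋ {s} {t} s≡t = ConvergesToℤ-cong
  (λ n → ≡.sym (≡.trans (≡.cong (ℚ._- t n) (s≡t n)) (ℚP.+-inverseʳ (t n)))) ConvergesToℤ-0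

≋-sym : ∀ {s t} → s ≋ t → t ≋ s
≋-sym {s} {t} s≋t = ConvergesToℤ-cong
  (λ n → solve 2 (λ a b → :- (a :- b) := b :- a) ≡.refl (s n) (t n)) (ConvergesToℤ-neg {λ n → s n ℚ.- t n} s≋t)

≋-trans : ∀ {s t u} → s ≋ t → t ≋ u → s ≋ u
≋-trans {s} {t} {u} s≋t t≋u = ConvergesToℤ-cong
  (λ n → solve 3 (λ a b c → (a :- b) :+ (b :- c) := a :- c) ≡.refl (s n) (t n) (u n))
  (ConvergesToℤ-+ {λ n → s n ℚ.- t n} {λ n → t n ℚ.- u n} s≋t t≋u)

≋-setoid : Setoid 0ℓ 0ℓ
≋-setoid = record
  { Carrier = Seq
  ; _≈_ = _≋_
  ; isEquivalence = record
    { refl  = λ {s} → ≡⇒≋ {s} {s} (λ _ → ≡.refl)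
    ; sym   = λ {s} {t} → ≋-sym {s} {t}
    ; trans = λ {s} {t} {u} → ≋-trans {s} {t} {u}
    }
  }

+ₛ-cong : ∀ {s s′ t t′} → s ≋ s′ → t ≋ t′ → s +ₛ t ≋ s′ +ₛ t′
+ₛ-cong {s} {s′} {t} {t′} s≋s′ t≋t′ = ConvergesToℤ-cong
  (λ n → solve 4 (λ a a′ b b′ → (a :- a′) :+ (b :- b′) := (a :+ b) :- (a′ :+ b′)) ≡.refl
           (s n) (s′ n) (t n) (t′ n))
  (ConvergesToℤ-+ {λ n → s n ℚ.- s′ n} {λ n → t n ℚ.- t′ n} s≋s′ t≋t′)

·ₛ-suc : ∀ m s n → (suc m ·ₛ s) n ≡ (s +ₛ (m ·ₛ s)) n
·ₛ-suc m s n = begin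
  (ℤ.+ suc m / 1) ℚ.* s n                     ≡⟨ ≡.cong (ℚ._* s n) (/1-homo-+ (ℤ.+ 1) (ℤ.+ m)) ⟨
  (1ℚ ℚ.+ ℤ.+ m / 1) ℚ.* s n                  ≡⟨ solve 2 (λ M a → (con 1ℚ :+ M) :* a := a :+ M :* a) ≡.refl (ℤ.+ m / 1) (s n) ⟩
  s n ℚ.+ (ℤ.+ m / 1) ℚ.* s n                 ∎
  where open ≡.≡-Reasoning

·ₛ-cong : ∀ m {s t} → s ≋ t → m ·ₛ s ≋ m ·ₛ t
·ₛ-cong zero {s} {t} _ = ≡⇒≋ (λ n → ≡.trans (ℚP.*-zeroˡ (s n)) (≡.sym (ℚP.*-zeroˡ (t n))))
·ₛ-cong (suc m) {s} {t} s≋t = begin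
  suc m ·ₛ s      ≈⟨ ≡⇒≋ (·ₛ-suc m s) ⟩
  s +ₛ (m ·ₛ s)   ≈⟨ +ₛ-cong {s} {t} {m ·ₛ s} {m ·ₛ t} s≋t (·ₛ-cong m {s} {t} s≋t) ⟩
  t +ₛ (m ·ₛ t)   ≈⟨ ≡⇒≋ (·ₛ-suc m t) ⟨
  suc m ·ₛ t      ∎
  where open SetoidReasoning ≋-setoid

cofactors-of-product : (F : List ℕ) →
  ∃ λ N → ∀ {i} → i ∈ F → 0 ℕ.< i → ∃ λ m → 0 ℕ.< m × N ≡ i ℕ.* m
cofactors-of-product F = product positives , λ i∈F 0<i →
  let i∣N = ∈⇒∣product (∈-filter⁺ (0 ℕ.<?_) i∈F 0<i)
  in quotient i∣N , >-nonZero⁻¹ _ {{quotient≢0 i∣N}} , m∣n⇒n≡m*quotient i∣N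
  where
  positives = filter (0 ℕ.<?_) F
  instance _ = product≢0 (All.map >-nonZero (all-filter (0 ℕ.<?_) F))

module _ {c ℓ : Level} (G : AbelianGroup c ℓ) where
  open AbelianGroup G renaming (Carrier to |G|)
  open RawMonoidDefinitions rawMonoid using () renaming (_×_ to _·_)
  open MonoidMult monoid using (×-congʳ; ×-assocˡ; ×-idem)
  open CommutativeMonoidMult commutativeMonoid using (×-distrib-+)
  open GroupProperties group using (x∙y⁻¹≈ε⇒x≈y; identityʳ-unique)

  ·-cancelˡ : IsTorsionFree G → ∀ i → 0 ℕ.< i → ∀ {a b} → i · a ≈ i · b → a ≈ b
  ·-cancelˡ torsionFree i 0<i {a} {b} ia≈ib = x∙y⁻¹≈ε⇒x≈y a b (torsionFree i 0<i (a ∙ b ⁻¹) (begin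
    i · (a ∙ b ⁻¹)       ≈⟨ ×-distrib-+ a (b ⁻¹) i ⟩
    i · a ∙ i · (b ⁻¹)   ≈⟨ ∙-congʳ ia≈ib ⟩
    i · b ∙ i · (b ⁻¹)   ≈⟨ ×-distrib-+ b (b ⁻¹) i ⟨
    i · (b ∙ b ⁻¹)       ≈⟨ ×-congʳ i (inverseʳ b) ⟩
    i · ε                ≈⟨ ×-idem (identityˡ ε) i ⟩
    ε                    ∎))
    where
    open SetoidReasoning setoid
    instance _ = >-nonZero 0<i

  ·-cancelˡ-* : IsTorsionFree G → ∀ i m → 0 ℕ.< i → ∀ {y h} → i · y ≈ (i ℕ.* m) · h → y ≈ m · h
  ·-cancelˡ-* torsionFree i m 0<i {y} {h} iy≈imh =
    ·-cancelˡ torsionFree i 0<i (trans iy≈imh (sym (×-assocˡ h i m)))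
  module _ {ι : ℤ → |G|} {π : |G| → ℝ} (exact : IsShortExact G ι π) where
    open IsShortExact exact
    open SetoidReasoning ≋-setoid

    πₛ : |G| → Seq
    πₛ g = proj₁ (π g)

    π-ε : πₛ ε ≋ λ _ → 0ℚ
    π-ε = begin
      πₛ ε            ≈⟨ π-cong ε (ι (ℤ.+ 0)) (sym ι0≈ε) ⟩
      πₛ (ι (ℤ.+ 0))  ≈⟨ im⊆ker (ℤ.+ 0) ⟩
      (λ _ → 0ℚ)      ∎
      where
      ι0≈ε : ι (ℤ.+ 0) ≈ ε
      ι0≈ε = identityʳ-unique (ι (ℤ.+ 0)) (ι (ℤ.+ 0)) (sym (ι-hom (ℤ.+ 0) (ℤ.+ 0)))

    π-· : ∀ m g → πₛ (m · g) ≋ m ·ₛ πₛ g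
    π-· zero g = begin
      πₛ ε            ≈⟨ π-ε ⟩
      (λ _ → 0ℚ)      ≈⟨ ≡⇒≋ (λ n → ℚP.*-zeroˡ (πₛ g n)) ⟨
      0 ·ₛ πₛ g       ∎
    π-· (suc m) g = begin
      πₛ (g ∙ m · g)        ≈⟨ π-hom g (m · g) ⟩
      πₛ g +ₛ πₛ (m · g)    ≈⟨ +ₛ-cong {πₛ g} {πₛ g} {πₛ (m · g)} (≡⇒≋ {πₛ g} (λ _ → ≡.refl)) (π-· m g) ⟩
      πₛ g +ₛ (m ·ₛ πₛ g)   ≈⟨ ≡⇒≋ (·ₛ-suc m (πₛ g)) ⟨
      suc m ·ₛ πₛ g         ∎

corollary3p11 : {c ℓ : Level} (G : AbelianGroup c ℓ) →
    IsDivisible G → IsTorsionFree G →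
    (ι : ℤ → AbelianGroup.Carrier G) (π : AbelianGroup.Carrier G → ℝ) →
    IsShortExact G ι π →
    HatπDense G π
corollary3p11 G _ torsionFree ι π exact x compatible F = N · h , matches
  where
  open AbelianGroup G
  open RawMonoidDefinitions rawMonoid using () renaming (_×_ to _·_)
  open MonoidMult monoid using (×-congˡ)
  open IsShortExact exact using (π-cong; π-surjective)
  open SetoidReasoning ≋-setoid
  N = proj₁ (cofactors-of-product F)
  h = proj₁ (π-surjective (x N))
  xₛ : ℕ → Seq
  xₛ i = proj₁ (x i)
  matches : ∀ i → i ∈ F → 0 ℕ.< i → ∀ y → i · y ≈ N · h → π y ≈ᵀ x i
  matches i i∈F 0<i y iy≈Nh with proj₂ (cofactors-of-product F) i∈F 0<i
  ... | m , 0<m , N≡im = begin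
    πₛ G exact y          ≈⟨ π-cong y (m · h) y≈mh ⟩
    πₛ G exact (m · h)    ≈⟨ π-· G exact m h ⟩
    m ·ₛ πₛ G exact h     ≈⟨ ·ₛ-cong m (proj₂ (π-surjective (x N))) ⟩
    m ·ₛ xₛ N             ≡⟨ ≡.cong (λ K → m ·ₛ xₛ K) N≡im ⟩
    m ·ₛ xₛ (i ℕ.* m)     ≈⟨ compatible i m 0<i 0<m ⟨
    xₛ i                  ∎
    where
    y≈mh : y ≈ m · h
    y≈mh = ·-cancelˡ-* G torsionFree i m 0<i (trans iy≈Nh (×-congˡ N≡im))
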